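{- Let $X,Y\subseteq\mathbb{N}_0^d$ be finite down-sets. Then \[ |X+Y| \geq 2^d\min(|X|,|Y|) - \sum_{I\subsetneq\{1,\dots,d\}} |\pi_I(X+Y)|. \]
   Context: $\mathbb{N}_0=\{0,1,2,\dots\}$. A set $B\subseteq\mathbb{N}_0^d$ is an $i$-down-set ($1\le i\le d$) if whenever $(x_1,\dots,x_d)\in B$, also $(x_1,\dots,x_{i-1},y_i,x_{i+1},\dots,x_d)\in B$ for all integers $0\le y_i\le x_i$; $B$ is a down-set if it is an $i$-down-set for every $1\le i\le d$. For $I\subseteq\{1,\dots,d\}$, $\pi_I:\mathbb{R}^d\to\mathbb{R}^d$ is the orthogonal projection $\pi_I(\sum_{i=1}^d x_ie_i):=\sum_{i\in I}x_ie_i$, where $e_1,\dots,e_d$ is the standard basis. $X+Y:=\{x+y:x\in X,y\in Y\}$. -}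

module Defs where

open import Data.Nat using (ℕ; zero; suc; _+_; _≤_)
open import Data.Nat.Properties using () renaming (_≟_ to _≟ℕ_)
open import Data.Bool using (Bool; true; false; if_then_else_)
open import Data.Fin using (Fin)
open import Data.Vec using (Vec; []; _∷_; lookup; _[_]≔_; zipWith; replicate)
open import Data.Vec.Properties using (≡-dec)
open import Data.List using (List; []; _∷_; length; map; concatMap; deduplicate; filter; _++_)
open import Data.Nat.ListAction using (sum)
open import Data.List.Membership.Propositional using (_∈_)
open import Relation.Binary.PropositionalEquality using (_≡_)
open import Relation.Nullary using (¬_; ¬?)

Point : ℕ → Set
Point d = Vec ℕ d

_≟ᵖ_ : ∀ {d} (x y : Point d) → Relation.Nullary.Dec (x ≡ y)
_≟ᵖ_ = ≡-dec _≟ℕ_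

-- A finite subset of ℕ₀^d is represented by a list enumerating it
-- (repetitions allowed; the set is the set of list members).
FinSet : ℕ → Set
FinSet d = List (Point d)

∣_∣ : ∀ {d} → FinSet d → ℕ
∣ X ∣ = length (deduplicate _≟ᵖ_ X)

-- i-down-set (i : Fin d, zero-based coordinate index)
IsDownSetIn : ∀ {d} → Fin d → FinSet d → Set
IsDownSetIn i B = ∀ x → x ∈ B → ∀ (y : ℕ) → y ≤ lookup x i → (x [ i ]≔ y) ∈ B

IsDownSet : ∀ {d} → FinSet d → Set
IsDownSet {d} B = ∀ (i : Fin d) → IsDownSetIn i B

_⊕_ : ∀ {d} → Point d → Point d → Point d
_⊕_ = zipWith _+_

_+ˢ_ : ∀ {d} → FinSet d → FinSet d → FinSet d
X +ˢ Y = concatMap (λ x → map (x ⊕_) Y) X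

Subset : ℕ → Set
Subset d = Vec Bool d

allSubsets : ∀ d → List (Subset d)
allSubsets zero = [] ∷ []
allSubsets (suc d) = map (false ∷_) (allSubsets d) ++ map (true ∷_) (allSubsets d)

full : ∀ d → Subset d
full d = replicate d true

_≟ˢ_ : ∀ {d} (I J : Subset d) → Relation.Nullary.Dec (I ≡ J)
_≟ˢ_ = ≡-dec Data.Bool._≟_

properSubsets : ∀ d → List (Subset d)
properSubsets d = filter (λ I → ¬? (I ≟ˢ full d)) (allSubsets d)

π : ∀ {d} → Subset d → Point d → Point d
π = zipWith (λ b v → if b then v else 0)

πˢ : ∀ {d} → Subset d → FinSet d → FinSet d
πˢ I S = map (π I) S

projSum : ∀ {d} → FinSet d → ℕ
projSum {d} S = sum (map (λ I → ∣ πˢ I S ∣) (properSubsets d))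

-- Write W(C) = Σ_{p ∈ C} 2^{z(p)}, where z(p) is the number of zero coordinates of p.
-- Since X + Y is a down-set, p ∈ π_I(X + Y) iff p ∈ X + Y and p vanishes off I, and p
-- vanishes off exactly 2^{z(p)} sets I; so the right-hand side is W(X + Y).  It remains to
-- show 2^d √(|A| |B|) ≤ W(C) for down-sets A, B and any C ⊇ A + B, by induction on d.
-- Slicing along the first coordinate, the induction hypothesis gives
-- 2^{d-1} √(|A_i| |B_j|) ≤ W(C_{i+j}), and W(C) = W(C_0) + Σ_k W(C_k) because points of
-- the slice 0 have one more zero coordinate.  A discrete one-dimensional Prékopa–Leindler
-- inequality then combines the slices.  Square roots are avoided by squaring, and all
-- sets are counted inside a large box {0, …, N-1}^d.

module Submission where

open import Data.Bool using (Bool; true; false; T; _∧_; _∨_)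
open import Data.Bool.Properties using (T-∧)
open import Data.Empty using (⊥-elim)
import Data.Fin as Fin
open import Data.List using (List; []; _∷_; length; map; deduplicate; filter; _++_; cartesianProductWith)
open import Data.List.Membership.Propositional using (_∈_)
import Data.List.Membership.DecPropositional as DecMembership
open import Data.List.Membership.Propositional.Properties
  using (∈-map⁺; ∈-map⁻; ∈-deduplicate⁻; ∈-deduplicate⁺; ∈-++⁺ˡ; ∈-++⁺ʳ; ∈-cartesianProductWith⁺; ∈-cartesianProductWith⁻)
open import Data.List.Properties using (map-++; map-∘; map-cong; map-id; filter-++; filter-all)
import Data.List.Relation.Unary.All as ListAll
import Data.List.Relation.Unary.All.Properties as ListAll
open import Data.List.Relation.Unary.AllPairs using ([]; _∷_)
open import Data.List.Relation.Unary.Any using (here; there)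
open import Data.List.Relation.Unary.Unique.Propositional using (Unique)
open import Data.List.Relation.Unary.Unique.DecPropositional.Properties using (deduplicate-!)
open import Data.Nat
open import Data.Nat.ListAction using (sum)
open import Data.Nat.ListAction.Properties using (sum-++)
open import Data.Nat.Properties
open import Algebra.Properties.CommutativeSemigroup +-commutativeSemigroup
  using (xy∙z≈xz∙y; x∙yz≈y∙xz) renaming (interchange to +-interchange)
open import Data.Nat.Tactic.RingSolver using (solve-∀)
open import Data.Product using (_×_; _,_; ∃; ∃₂; proj₁; proj₂)
open import Data.Sum using (_⊎_; inj₁; inj₂; [_,_]′)
open import Data.Unit using (tt)
open import Data.Vec using ([]; _∷_; lookup; _[_]≔_)
import Data.Vec as Vec
open import Data.Vec.Relation.Binary.Pointwise.Inductive as Pointwise using (Pointwise; []; _∷_)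
open import Data.Vec.Relation.Unary.All using (All; []; _∷_)
import Data.Vec.Relation.Unary.All as VecAll
open import Defs
open import Function using (_∘′_)
open import Function.Bundles using (Equivalence)
open import Relation.Binary.PropositionalEquality
open import Relation.Nullary using (Dec; yes; no; does; ¬_; ¬?; contradiction)
open import Relation.Nullary.Decidable using (dec-true; dec-false)

m*m≤n*n⇒m≤n : ∀ {m n} → m * m ≤ n * n → m ≤ n
m*m≤n*n⇒m≤n {m} {n} m*m≤n*n with m ≤? n
... | yes m≤n = m≤n
... | no m≰n = contradiction m*m≤n*n (<⇒≱ (*-mono-< n<m n<m))
  where n<m = ≰⇒> m≰n

c*[m⊓n]-square≤c*c*[m*n] : ∀ c m n → c * (m ⊓ n) * (c * (m ⊓ n)) ≤ c * c * (m * n)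
c*[m⊓n]-square≤c*c*[m*n] c m n = subst (_≤ c * c * (m * n)) (regroup c (m ⊓ n) (m ⊓ n))
  (*-monoʳ-≤ (c * c) (*-mono-≤ (m⊓n≤m m n) (m⊓n≤n m n)))
  where
  regroup : ∀ c a b → c * c * (a * b) ≡ c * a * (c * b)
  regroup = solve-∀

4*m*n≤[m+n]*[m+n] : ∀ m n → 4 * (m * n) ≤ (m + n) * (m + n)
4*m*n≤[m+n]*[m+n] m n = [ ordered , swapped ]′ (≤-total m n)
  where
  ordered : ∀ {m n} → m ≤ n → 4 * (m * n) ≤ (m + n) * (m + n)
  ordered {m} {n} m≤n = subst (λ k → 4 * (m * k) ≤ (m + k) * (m + k)) (m+[n∸m]≡n m≤n)
    (subst (4 * (m * (m + t)) ≤_) (expand m t) (m≤m+n _ (t * t)))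
    where
    t = n ∸ m
    expand : ∀ m t → 4 * (m * (m + t)) + t * t ≡ (m + (m + t)) * (m + (m + t))
    expand = solve-∀
  swapped : n ≤ m → 4 * (m * n) ≤ (m + n) * (m + n)
  swapped n≤m = subst₂ _≤_ (cong (4 *_) (*-comm n m)) (cong₂ _*_ (+-comm n m) (+-comm n m)) (ordered n≤m)

*-zero-≤ : ∀ c {m n} o → m ≡ 0 ⊎ n ≡ 0 → c * m * n ≤ o
*-zero-≤ c {n = n} o (inj₁ refl) = ≤-trans (≤-reflexive (cong (_* n) (*-zeroʳ c))) z≤n
*-zero-≤ c {m = m} o (inj₂ refl) = ≤-trans (≤-reflexive (*-zeroʳ (c * m))) z≤n

infix 4 _≤_·√_

_≤_·√_ : ℕ → ℕ → ℕ → Set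
b ≤ a ·√ P = b * b ≤ a * a * P

·√-+ : ∀ {P a b c e} → b ≤ a ·√ P → e ≤ c ·√ P → b + e ≤ a + c ·√ P
·√-+ {P} {a} {b} {c} {e} b≤a√P e≤c√P =
  subst₂ _≤_ (square b e) (scaledSquare a c P) (+-mono-≤ (+-mono-≤ b≤a√P e≤c√P) (*-monoʳ-≤ 2 cross))
  where
  regroup : ∀ b e → b * b * (e * e) ≡ b * e * (b * e)
  regroup = solve-∀
  regroupP : ∀ a c P → a * a * P * (c * c * P) ≡ a * c * P * (a * c * P)
  regroupP = solve-∀
  cross : b * e ≤ a * c * P
  cross = m*m≤n*n⇒m≤n (subst₂ _≤_ (regroup b e) (regroupP a c P) (*-mono-≤ b≤a√P e≤c√P))
  square : ∀ b e → b * b + e * e + 2 * (b * e) ≡ (b + e) * (b + e)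
  square = solve-∀
  scaledSquare : ∀ a c P → a * a * P + c * c * P + 2 * (a * c * P) ≡ (a + c) * (a + c) * P
  scaledSquare = solve-∀

sumTo : ℕ → (ℕ → ℕ) → ℕ
sumTo zero    f = 0
sumTo (suc n) f = sumTo n f + f n

sumTo-cong : ∀ n {f g : ℕ → ℕ} → (∀ k → k < n → f k ≡ g k) → sumTo n f ≡ sumTo n g
sumTo-cong zero    f≗g = refl
sumTo-cong (suc n) f≗g = cong₂ _+_ (sumTo-cong n (λ k k<n → f≗g k (m<n⇒m<1+n k<n))) (f≗g n ≤-refl)

sumTo-mono : ∀ n {f g : ℕ → ℕ} → (∀ k → k < n → f k ≤ g k) → sumTo n f ≤ sumTo n g
sumTo-mono zero    f≤g = z≤n
sumTo-mono (suc n) f≤g = +-mono-≤ (sumTo-mono n (λ k k<n → f≤g k (m<n⇒m<1+n k<n))) (f≤g n ≤-refl)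

sumTo-monoˡ : ∀ f {m n} → m ≤ n → sumTo m f ≤ sumTo n f
sumTo-monoˡ f {n = zero}  z≤n = z≤n
sumTo-monoˡ f {m} {suc n} m≤1+n with m ≟ suc n
... | yes refl = ≤-refl
... | no m≢1+n = ≤-trans (sumTo-monoˡ f (m<1+n⇒m≤n (≤∧≢⇒< m≤1+n m≢1+n))) (m≤m+n _ _)

sumTo-+ : ∀ n (f g : ℕ → ℕ) → sumTo n (λ k → f k + g k) ≡ sumTo n f + sumTo n g
sumTo-+ zero    f g = refl
sumTo-+ (suc n) f g rewrite sumTo-+ n f g = +-interchange (sumTo n f) (sumTo n g) (f n) (g n)

sumTo-*ˡ : ∀ n (f : ℕ → ℕ) c → sumTo n (λ k → c * f k) ≡ c * sumTo n f
sumTo-*ˡ zero    f c = sym (*-zeroʳ c)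
sumTo-*ˡ (suc n) f c rewrite sumTo-*ˡ n f c = sym (*-distribˡ-+ c (sumTo n f) (f n))

sumTo-*ʳ : ∀ n (f : ℕ → ℕ) c → sumTo n (λ k → f k * c) ≡ sumTo n f * c
sumTo-*ʳ zero    f c = refl
sumTo-*ʳ (suc n) f c rewrite sumTo-*ʳ n f c = sym (*-distribʳ-+ c (sumTo n f) (f n))

sumTo-zero : ∀ n {f : ℕ → ℕ} → (∀ k → k < n → f k ≡ 0) → sumTo n f ≡ 0
sumTo-zero zero    f≗0 = refl
sumTo-zero (suc n) f≗0 rewrite sumTo-zero n (λ k k<n → f≗0 k (m<n⇒m<1+n k<n)) = f≗0 n ≤-refl

sumTo-antitone-zero : ∀ n {f : ℕ → ℕ} → (∀ i → f i ≤ f 0) → f 0 ≡ 0 → sumTo n f ≡ 0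
sumTo-antitone-zero n {f} f≤f₀ f₀≡0 = sumTo-zero n (λ i _ → n≤0⇒n≡0 (subst (f i ≤_) f₀≡0 (f≤f₀ i)))

sumTo-suc : ∀ n (f : ℕ → ℕ) → sumTo (suc n) f ≡ f 0 + sumTo n (λ k → f (suc k))
sumTo-suc zero    f = sym (+-identityʳ _)
sumTo-suc (suc n) f rewrite sumTo-suc n f = +-assoc (f 0) _ _

module _ (_◁_ : ℕ → ℕ → Set) (◁-+ : ∀ {b a e c} → b ◁ a → e ◁ c → (b + e) ◁ (a + c)) where

  -- Walk from (0, 0) to (m, n), always advancing the index whose next term is smaller:
  -- that term is then the minimum u i ⊓ v j, which the hypothesis bounds by the new h (i + j).
  staircase : (u v h : ℕ → ℕ) → (∀ i → u i ≤ u 0) → (∀ j → v j ≤ v 0) → u 0 ≡ v 0 →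
              (∀ i j → (u i ⊓ v j) ◁ h (i + j)) →
              ∀ m n → (sumTo (suc m) u + sumTo (suc n) v) ◁ (h 0 + sumTo (suc (m + n)) h)
  staircase u v h u≤u₀ v≤v₀ u₀≡v₀ hyp = go
    where
    ◁-+-≡ : ∀ {b a e c b′ a′} → b + e ≡ b′ → a + c ≡ a′ → b ◁ a → e ◁ c → b′ ◁ a′
    ◁-+-≡ refl refl = ◁-+
    hyp-u : ∀ {i j} → u i ≤ v j → u i ◁ h (i + j)
    hyp-u {i} {j} uᵢ≤vⱼ = subst (_◁ h (i + j)) (m≤n⇒m⊓n≡m uᵢ≤vⱼ) (hyp i j)
    hyp-v : ∀ {i j} → v j ≤ u i → v j ◁ h (i + j)
    hyp-v {i} {j} vⱼ≤uᵢ = subst (_◁ h (i + j)) (m≥n⇒m⊓n≡n vⱼ≤uᵢ) (hyp i j)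
    go : ∀ m n → (sumTo (suc m) u + sumTo (suc n) v) ◁ (h 0 + sumTo (suc (m + n)) h)
    go zero zero = subst (λ w → (u 0 + w) ◁ (h 0 + h 0)) u₀≡v₀ (◁-+ (hyp-u u₀≤v₀) (hyp-u u₀≤v₀))
      where u₀≤v₀ = ≤-reflexive u₀≡v₀
    go zero (suc n) = ◁-+-≡ (+-assoc (u 0) _ _) (+-assoc (h 0) _ _)
      (go zero n) (hyp-v (subst (v (suc n) ≤_) (sym u₀≡v₀) (v≤v₀ (suc n))))
    go (suc m) zero = ◁-+-≡ (xy∙z≈xz∙y (sumTo (suc m) u) (v 0) _) (+-assoc (h 0) _ _)
      (go m zero) (hyp-u (subst (u (suc m) ≤_) u₀≡v₀ (u≤u₀ (suc m))))
    go (suc m) (suc n) with u (suc m) ≤? v (suc n)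
    ... | yes uₘ≤vₙ = ◁-+-≡ (xy∙z≈xz∙y (sumTo (suc m) u) _ _) (+-assoc (h 0) _ _)
      (go m (suc n)) (hyp-u uₘ≤vₙ)
    ... | no uₘ≰vₙ =
      subst (λ k → (sumTo (suc (suc m)) u + sumTo (suc (suc n)) v) ◁ (h 0 + sumTo (suc k) h)) (sym (+-suc (suc m) n))
        (◁-+-≡ (+-assoc (sumTo (suc (suc m)) u) _ _) (+-assoc (h 0) _ _)
          (go (suc m) n) (subst (λ k → v (suc n) ◁ h k) (+-suc (suc m) n) (hyp-v (<⇒≤ (≰⇒> uₘ≰vₙ)))))

module _ (G : ℕ) (x y H : ℕ → ℕ) (x≤x₀ : ∀ i → x i ≤ x 0) (y≤y₀ : ∀ j → y j ≤ y 0)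
         (hyp : ∀ i j → G * G * x i * y j ≤ H (i + j) * H (i + j)) where

  -- Scaling x by y₀ and y by x₀ makes both sequences start at P = x₀ y₀, as staircase needs;
  -- AM–GM then turns the resulting bound on X y₀ + Y x₀ into one on 2 √(X Y P).
  prekopa-leindler : ∀ N K → N + N ≤ K →
    2 * G * (2 * G) * sumTo N x * sumTo N y ≤ (H 0 + sumTo K H) * (H 0 + sumTo K H)
  prekopa-leindler zero K _ = *-zero-≤ (2 * G * (2 * G)) _ (inj₁ refl)
  prekopa-leindler (suc N′) K 2N≤K with x 0 ≟ 0 | y 0 ≟ 0
  ... | yes x₀≡0 | _      = *-zero-≤ (2 * G * (2 * G)) _ (inj₁ (sumTo-antitone-zero (suc N′) x≤x₀ x₀≡0))
  ... | no _     | yes y₀≡0 = *-zero-≤ (2 * G * (2 * G)) _ (inj₂ (sumTo-antitone-zero (suc N′) y≤y₀ y₀≡0))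
  ... | no x₀≢0  | no y₀≢0 = *-cancelʳ-≤ _ _ P {{>-nonZero (*-mono-< (n≢0⇒n>0 x₀≢0) (n≢0⇒n>0 y₀≢0))}} (begin
    2 * G * (2 * G) * X * Y * P  ≡⟨ regroup G X Y (x 0) (y 0) ⟩
    G * G * (4 * (U * V))        ≤⟨ *-monoʳ-≤ (G * G) (4*m*n≤[m+n]*[m+n] U V) ⟩
    G * G * ((U + V) * (U + V))  ≡⟨ square G (U + V) ⟩
    G * (U + V) * (G * (U + V))  ≡⟨ cong (λ w → G * w * (G * w)) (sym (cong₂ _+_ (sumTo-*ʳ N x (y 0)) (sumTo-*ʳ N y (x 0)))) ⟩
    G * (sumTo N u + sumTo N v) * (G * (sumTo N u + sumTo N v))
                                 ≤⟨ staircase _◁_ (λ {b a e c} → ◁-+ {b} {a} {e} {c})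
                                      u v H u≤u₀ v≤v₀ (*-comm (x 0) (y 0)) minBound N′ N′ ⟩
    S′ * S′ * P                  ≤⟨ *-monoˡ-≤ P (*-mono-≤ S′≤S S′≤S) ⟩
    S * S * P                    ∎)
    where
    open ≤-Reasoning
    N = suc N′
    X = sumTo N x
    Y = sumTo N y
    P = x 0 * y 0
    u v : ℕ → ℕ
    u i = x i * y 0
    v j = y j * x 0
    U = X * y 0
    V = Y * x 0
    S′ = H 0 + sumTo (suc (N′ + N′)) H
    S = H 0 + sumTo K H
    regroup : ∀ G X Y a b → 2 * G * (2 * G) * X * Y * (a * b) ≡ G * G * (4 * ((X * b) * (Y * a)))
    regroup = solve-∀
    square : ∀ G m → G * G * (m * m) ≡ G * m * (G * m)
    square = solve-∀
    regroupHyp : ∀ G a b c d → G * G * (a * c * (b * d)) ≡ G * G * a * b * (d * c)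
    regroupHyp = solve-∀
    _◁_ : ℕ → ℕ → Set
    b ◁ a = G * b ≤ a ·√ P
    ◁-+ : ∀ {b a e c} → b ◁ a → e ◁ c → (b + e) ◁ (a + c)
    ◁-+ {b} {a} {e} {c} Gb≤a√P Ge≤c√P =
      subst (λ w → w ≤ a + c ·√ P) (sym (*-distribˡ-+ G b e)) (·√-+ {P} {a} {G * b} {c} {G * e} Gb≤a√P Ge≤c√P)
    minBound : ∀ i j → (u i ⊓ v j) ◁ H (i + j)
    minBound i j = begin
      G * (u i ⊓ v j) * (G * (u i ⊓ v j)) ≤⟨ c*[m⊓n]-square≤c*c*[m*n] G (u i) (v j) ⟩
      G * G * (u i * v j)                 ≡⟨ regroupHyp G (x i) (y j) (y 0) (x 0) ⟩
      G * G * x i * y j * P               ≤⟨ *-monoˡ-≤ P (hyp i j) ⟩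
      H (i + j) * H (i + j) * P           ∎
    u≤u₀ : ∀ i → u i ≤ u 0
    u≤u₀ i = *-monoˡ-≤ (y 0) (x≤x₀ i)
    v≤v₀ : ∀ j → v j ≤ v 0
    v≤v₀ j = *-monoˡ-≤ (x 0) (y≤y₀ j)
    S′≤S : S′ ≤ S
    S′≤S = +-monoʳ-≤ (H 0) (sumTo-monoˡ H (≤-trans (s≤s (+-monoʳ-≤ N′ (n≤1+n N′))) 2N≤K))

𝟙 : Bool → ℕ
𝟙 true  = 1
𝟙 false = 0

𝟙-∧ : ∀ a b → 𝟙 (a ∧ b) ≡ 𝟙 a * 𝟙 b
𝟙-∧ false b     = refl
𝟙-∧ true  false = refl
𝟙-∧ true  true  = refl

𝟙-∨ : ∀ a b → ¬ (T a × T b) → 𝟙 (a ∨ b) ≡ 𝟙 a + 𝟙 b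
𝟙-∨ false b     _        = refl
𝟙-∨ true  false _        = refl
𝟙-∨ true  true  disjoint = ⊥-elim (disjoint (tt , tt))

𝟙-mono : ∀ {a b} → (T a → T b) → 𝟙 a ≤ 𝟙 b
𝟙-mono {false}         _   = z≤n
𝟙-mono {true} {true}  _   = ≤-refl
𝟙-mono {true} {false} a⇒b = ⊥-elim (a⇒b tt)

𝟙-cong : ∀ {a b} → (T a → T b) → (T b → T a) → 𝟙 a ≡ 𝟙 b
𝟙-cong a⇒b b⇒a = ≤-antisym (𝟙-mono a⇒b) (𝟙-mono b⇒a)

T-does⇒ : ∀ {A : Set} (a? : Dec A) → T (does a?) → A
T-does⇒ (yes a) _ = a

⇒T-does : ∀ {A : Set} (a? : Dec A) → A → T (does a?)
⇒T-does (yes _) _ = tt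
⇒T-does (no ¬a) a = ¬a a

sumTo-δ : ∀ n {x} → x < n → sumTo n (λ k → 𝟙 (does (k ≟ x))) ≡ 1
sumTo-δ (suc n) {x} x<1+n with n ≟ x
... | yes refl = cong₂ _+_ (sumTo-zero n (λ k k<n → cong 𝟙 (dec-false (k ≟ n) (<⇒≢ k<n))))
                           (cong 𝟙 (dec-true (n ≟ n) refl))
... | no n≢x   = begin
  δₙ + 𝟙 (does (n ≟ x)) ≡⟨ cong (λ b → δₙ + 𝟙 b) (dec-false (n ≟ x) n≢x) ⟩
  δₙ + 0                ≡⟨ +-identityʳ δₙ ⟩
  δₙ                    ≡⟨ sumTo-δ n (≤∧≢⇒< (m<1+n⇒m≤n x<1+n) (≢-sym n≢x)) ⟩
  1                     ∎
  where
  open ≡-Reasoning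
  δₙ = sumTo n (λ k → 𝟙 (does (k ≟ x)))

_≤ᵖ_ : ∀ {d} → Point d → Point d → Set
_≤ᵖ_ = Pointwise _≤_

InBox : ∀ {d} → ℕ → Point d → Set
InBox N = All (_< N)

InBox-mono : ∀ {d} {M N} {p : Point d} → M ≤ N → InBox M p → InBox N p
InBox-mono M≤N = VecAll.map (λ x<M → <-≤-trans x<M M≤N)

InBox-antitone : ∀ {d N} {p q : Point d} → q ≤ᵖ p → InBox N p → InBox N q
InBox-antitone []          []          = []
InBox-antitone (y≤x ∷ q≤p) (x<N ∷ p∈) = ≤-<-trans y≤x x<N ∷ InBox-antitone q≤p p∈

InBox-sum : ∀ {d} (p : Point d) → InBox (suc (Vec.sum p)) p
InBox-sum []      = []
InBox-sum (x ∷ p) = s≤s (m≤m+n x _) ∷ InBox-mono (s≤s (m≤n+m _ x)) (InBox-sum p)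

bounded : ∀ {d} (L : FinSet d) → ∃ λ N → ∀ x → x ∈ L → InBox N x
bounded []      = 0 , λ _ ()
bounded (x ∷ L) with bounded L
... | N , L⊆ = suc (Vec.sum x) ⊔ N , λ where
  _ (here refl) → InBox-mono (m≤m⊔n _ N) (InBox-sum x)
  y (there y∈L) → InBox-mono (m≤n⊔m _ N) (L⊆ y y∈L)

boxSum : ∀ d → ℕ → (Point d → ℕ) → ℕ
boxSum zero    N f = f []
boxSum (suc d) N f = sumTo N (λ k → boxSum d N (λ p → f (k ∷ p)))

boxSum-cong : ∀ d N {f g : Point d → ℕ} → (∀ p → InBox N p → f p ≡ g p) → boxSum d N f ≡ boxSum d N g
boxSum-cong zero    N f≗g = f≗g [] []
boxSum-cong (suc d) N f≗g = sumTo-cong N (λ k k<N → boxSum-cong d N (λ p p∈ → f≗g (k ∷ p) (k<N ∷ p∈)))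

boxSum-mono : ∀ d N {f g : Point d → ℕ} → (∀ p → InBox N p → f p ≤ g p) → boxSum d N f ≤ boxSum d N g
boxSum-mono zero    N f≤g = f≤g [] []
boxSum-mono (suc d) N f≤g = sumTo-mono N (λ k k<N → boxSum-mono d N (λ p p∈ → f≤g (k ∷ p) (k<N ∷ p∈)))

boxSum-+ : ∀ d N (f g : Point d → ℕ) → boxSum d N (λ p → f p + g p) ≡ boxSum d N f + boxSum d N g
boxSum-+ zero    N f g = refl
boxSum-+ (suc d) N f g = trans (sumTo-cong N (λ k _ → boxSum-+ d N _ _)) (sumTo-+ N _ _)

boxSum-*ˡ : ∀ d N (f : Point d → ℕ) c → boxSum d N (λ p → c * f p) ≡ c * boxSum d N f
boxSum-*ˡ zero    N f c = refl
boxSum-*ˡ (suc d) N f c = trans (sumTo-cong N (λ k _ → boxSum-*ˡ d N _ c)) (sumTo-*ˡ N _ c)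

boxSum-zero : ∀ d N → boxSum d N (λ _ → 0) ≡ 0
boxSum-zero zero    N = refl
boxSum-zero (suc d) N = trans (sumTo-cong N (λ k _ → boxSum-zero d N)) (sumTo-zero N (λ _ _ → refl))

boxSum-δ : ∀ d N {x : Point d} → InBox N x → boxSum d N (λ p → 𝟙 (does (p ≟ᵖ x))) ≡ 1
boxSum-δ zero    N []                = refl
boxSum-δ (suc d) N {x₀ ∷ x} (x₀<N ∷ x∈) = trans (sumTo-cong N slice) (sumTo-δ N x₀<N)
  where
  slice : ∀ k → k < N → boxSum d N (λ p → 𝟙 (does ((k ∷ p) ≟ᵖ (x₀ ∷ x)))) ≡ 𝟙 (does (k ≟ x₀))
  slice k _ = begin
    boxSum d N (λ p → 𝟙 (does (k ≟ x₀) ∧ does (p ≟ᵖ x)))     ≡⟨ boxSum-cong d N (λ p _ → 𝟙-∧ (does (k ≟ x₀)) _) ⟩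
    boxSum d N (λ p → 𝟙 (does (k ≟ x₀)) * 𝟙 (does (p ≟ᵖ x))) ≡⟨ boxSum-*ˡ d N _ (𝟙 (does (k ≟ x₀))) ⟩
    𝟙 (does (k ≟ x₀)) * boxSum d N (λ p → 𝟙 (does (p ≟ᵖ x))) ≡⟨ cong (𝟙 (does (k ≟ x₀)) *_) (boxSum-δ d N x∈) ⟩
    𝟙 (does (k ≟ x₀)) * 1                                     ≡⟨ *-identityʳ _ ⟩
    𝟙 (does (k ≟ x₀))                                         ∎
    where open ≡-Reasoning

zeros : ∀ {d} → Point d → ℕ
zeros []          = 0
zeros (zero  ∷ p) = suc (zeros p)
zeros (suc _ ∷ p) = zeros p

count : ∀ d → ℕ → (Point d → Bool) → ℕ
count d N A = boxSum d N (λ p → 𝟙 (A p))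

weight : ∀ d → ℕ → (Point d → Bool) → ℕ
weight d M C = boxSum d M (λ p → 𝟙 (C p) * 2 ^ zeros p)

weight-suc : ∀ d M (C : Point (suc d) → Bool) →
  weight (suc d) (suc M) C ≡
  weight d (suc M) (λ p → C (0 ∷ p)) + sumTo (suc M) (λ k → weight d (suc M) (λ p → C (k ∷ p)))
weight-suc d M C = begin
  weight (suc d) (suc M) C                                                   ≡⟨ sumTo-suc M _ ⟩
  boxSum d (suc M) (λ p → 𝟙 (C (0 ∷ p)) * (2 * 2 ^ zeros p)) + Hsuc         ≡⟨ cong (_+ Hsuc) doubled ⟩
  H 0 + H 0 + Hsuc                                                           ≡⟨ +-assoc (H 0) (H 0) Hsuc ⟩
  H 0 + (H 0 + Hsuc)                                                         ≡⟨ cong (H 0 +_) (sumTo-suc M H) ⟨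
  H 0 + sumTo (suc M) H                                                      ∎
  where
  open ≡-Reasoning
  H : ℕ → ℕ
  H k = weight d (suc M) (λ p → C (k ∷ p))
  Hsuc = sumTo M (λ k → H (suc k))
  double : ∀ c w → c * (2 * w) ≡ c * w + c * w
  double = solve-∀
  doubled : boxSum d (suc M) (λ p → 𝟙 (C (0 ∷ p)) * (2 * 2 ^ zeros p)) ≡ H 0 + H 0
  doubled = trans (boxSum-cong d (suc M) (λ p _ → double (𝟙 (C (0 ∷ p))) (2 ^ zeros p))) (boxSum-+ d (suc M) _ _)

DownClosed : ∀ {d} → (Point d → Bool) → Set
DownClosed A = ∀ {p q} → q ≤ᵖ p → T (A p) → T (A q)

counts≤weight : ∀ d N M → N + N ≤ M → (A B C : Point d → Bool) → DownClosed A → DownClosed B →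
  (∀ a b → T (A a) → T (B b) → T (C (a ⊕ b))) →
  2 ^ d * 2 ^ d * count d N A * count d N B ≤ weight d M C * weight d M C
counts≤weight zero N M _ A B C _ _ A+B⊆C = single (A []) (B []) (C []) (A+B⊆C [] [])
  where
  single : ∀ a b c → (T a → T b → T c) → 1 * 1 * 𝟙 a * 𝟙 b ≤ 𝟙 c * 1 * (𝟙 c * 1)
  single false b     c     _ = z≤n
  single true  false c     _ = z≤n
  single true  true  true  _ = ≤-refl
  single true  true  false a∧b⇒c = ⊥-elim (a∧b⇒c tt tt)
counts≤weight (suc d) zero M _ A B C _ _ _ = *-zero-≤ (2 ^ suc d * 2 ^ suc d) _ (inj₁ refl)
counts≤weight (suc d) (suc N) (suc M) 2N≤M A B C A↓ B↓ A+B⊆C =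
  subst (λ w → 2 ^ suc d * 2 ^ suc d * count (suc d) (suc N) A * count (suc d) (suc N) B ≤ w * w) (sym (weight-suc d M C))
    (prekopa-leindler (2 ^ d) x y H x≤x₀ y≤y₀ slices (suc N) (suc M) 2N≤M)
  where
  x y H : ℕ → ℕ
  x i = count d (suc N) (λ p → A (i ∷ p))
  y j = count d (suc N) (λ p → B (j ∷ p))
  H k = weight d (suc M) (λ p → C (k ∷ p))
  x≤x₀ : ∀ i → x i ≤ x 0
  x≤x₀ i = boxSum-mono d (suc N) (λ p _ → 𝟙-mono (A↓ (z≤n ∷ Pointwise.refl ≤-refl)))
  y≤y₀ : ∀ j → y j ≤ y 0
  y≤y₀ j = boxSum-mono d (suc N) (λ p _ → 𝟙-mono (B↓ (z≤n ∷ Pointwise.refl ≤-refl)))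
  slices : ∀ i j → 2 ^ d * 2 ^ d * x i * y j ≤ H (i + j) * H (i + j)
  slices i j = counts≤weight d (suc N) (suc M) 2N≤M (λ p → A (i ∷ p)) (λ p → B (j ∷ p)) (λ p → C (i + j ∷ p))
    (λ q≤p → A↓ (≤-refl ∷ q≤p)) (λ q≤p → B↓ (≤-refl ∷ q≤p)) (λ a b → A+B⊆C (i ∷ a) (j ∷ b))
counts≤weight (suc d) (suc N) zero () _ _ _ _ _ _

_∈ᵇ_ : ∀ {d} → Point d → FinSet d → Bool
p ∈ᵇ L = does (DecMembership._∈?_ _≟ᵖ_ p L)

∈ᵇ⇒∈ : ∀ {d} {p : Point d} L → T (p ∈ᵇ L) → p ∈ L
∈ᵇ⇒∈ {p = p} L = T-does⇒ (DecMembership._∈?_ _≟ᵖ_ p L)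

∈⇒∈ᵇ : ∀ {d} {p : Point d} L → p ∈ L → T (p ∈ᵇ L)
∈⇒∈ᵇ {p = p} L = ⇒T-does (DecMembership._∈?_ _≟ᵖ_ p L)

length≡count : ∀ {d} N (L : FinSet d) → Unique L → (∀ x → x ∈ L → InBox N x) → length L ≡ count d N (_∈ᵇ L)
length≡count {d} N []      _            _   = sym (boxSum-zero d N)
length≡count {d} N (x ∷ L) (x∉L ∷ uniq) L⊆ = sym (begin
  count d N (_∈ᵇ (x ∷ L))                                     ≡⟨ boxSum-cong d N (λ p _ → 𝟙-∨ _ (p ∈ᵇ L) (disjoint p)) ⟩
  boxSum d N (λ p → 𝟙 (does (p ≟ᵖ x)) + 𝟙 (p ∈ᵇ L))           ≡⟨ boxSum-+ d N _ _ ⟩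
  boxSum d N (λ p → 𝟙 (does (p ≟ᵖ x))) + count d N (_∈ᵇ L)    ≡⟨ cong₂ _+_ (boxSum-δ d N (L⊆ x (here refl))) (sym tail) ⟩
  suc (length L)                                              ∎)
  where
  open ≡-Reasoning
  tail : length L ≡ count d N (_∈ᵇ L)
  tail = length≡count N L uniq (λ y y∈ → L⊆ y (there y∈))
  disjoint : ∀ p → ¬ (T (does (p ≟ᵖ x)) × T (p ∈ᵇ L))
  disjoint p (p≡x , p∈L) with refl ← T-does⇒ (p ≟ᵖ x) p≡x = ListAll.lookup x∉L (∈ᵇ⇒∈ L p∈L) refl

∣∣≡count : ∀ {d} N (L : FinSet d) → (∀ x → x ∈ L → InBox N x) → ∣ L ∣ ≡ count d N (_∈ᵇ L)
∣∣≡count {d} N L L⊆ = begin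
  length L′          ≡⟨ length≡count N L′ (deduplicate-! _≟ᵖ_ L) (λ x x∈ → L⊆ x (∈-deduplicate⁻ _≟ᵖ_ L x∈)) ⟩
  count d N (_∈ᵇ L′) ≡⟨ boxSum-cong d N (λ p _ → 𝟙-cong (∈⇒∈ᵇ L ∘′ ∈-deduplicate⁻ _≟ᵖ_ L ∘′ ∈ᵇ⇒∈ L′)
                                                         (∈⇒∈ᵇ L′ ∘′ ∈-deduplicate⁺ _≟ᵖ_ ∘′ ∈ᵇ⇒∈ L)) ⟩
  count d N (_∈ᵇ L)  ∎
  where
  open ≡-Reasoning
  L′ = deduplicate _≟ᵖ_ L

sum-++-maps : ∀ {A B : Set} (f : B → ℕ) (g h : A → B) xs ys →
  sum (map f (map g xs ++ map h ys)) ≡ sum (map (f ∘′ g) xs) + sum (map (f ∘′ h) ys)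
sum-++-maps f g h xs ys = begin
  sum (map f (map g xs ++ map h ys))                 ≡⟨ cong sum (map-++ f (map g xs) (map h ys)) ⟩
  sum (map f (map g xs) ++ map f (map h ys))         ≡⟨ sum-++ (map f (map g xs)) _ ⟩
  sum (map f (map g xs)) + sum (map f (map h ys))    ≡⟨ cong₂ (λ as bs → sum as + sum bs) (map-∘ xs) (map-∘ ys) ⟨
  sum (map (f ∘′ g) xs) + sum (map (f ∘′ h) ys)      ∎
  where open ≡-Reasoning

sum-map-zero : ∀ {A : Set} (xs : List A) → sum (map (λ _ → 0) xs) ≡ 0
sum-map-zero []       = refl
sum-map-zero (x ∷ xs) = sum-map-zero xs

sum-map-*ˡ : ∀ {A : Set} (f : A → ℕ) c xs → sum (map (λ x → c * f x) xs) ≡ c * sum (map f xs)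
sum-map-*ˡ f c []       = sym (*-zeroʳ c)
sum-map-*ˡ f c (x ∷ xs) = trans (cong (c * f x +_) (sum-map-*ˡ f c xs)) (sym (*-distribˡ-+ c (f x) _))

boxSum-sum : ∀ {A : Set} d N (xs : List A) (g : A → Point d → ℕ) →
  boxSum d N (λ p → sum (map (λ a → g a p) xs)) ≡ sum (map (λ a → boxSum d N (g a)) xs)
boxSum-sum d N []       g = boxSum-zero d N
boxSum-sum d N (a ∷ xs) g = trans (boxSum-+ d N _ _) (cong (boxSum d N (g a) +_) (boxSum-sum d N xs g))

-- Deciding (true ∷ I) ≟ˢ (true ∷ J) computes to deciding I ≟ˢ J.
filter-proper-true : ∀ {d} (Is : List (Subset d)) →
  filter (λ J → ¬? (J ≟ˢ full (suc d))) (map (true ∷_) Is) ≡ map (true ∷_) (filter (λ J → ¬? (J ≟ˢ full d)) Is)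
filter-proper-true []           = refl
filter-proper-true {d} (I ∷ Is) with does (I ≟ˢ full d)
... | true  = filter-proper-true Is
... | false = cong ((true ∷ I) ∷_) (filter-proper-true Is)

properSubsets-suc : ∀ d → properSubsets (suc d) ≡ map (false ∷_) (allSubsets d) ++ map (true ∷_) (properSubsets d)
properSubsets-suc d = begin
  filter P? (map (false ∷_) As ++ map (true ∷_) As)               ≡⟨ filter-++ P? (map (false ∷_) As) _ ⟩
  filter P? (map (false ∷_) As) ++ filter P? (map (true ∷_) As)   ≡⟨ cong₂ _++_ (filter-all P? none-full) (filter-proper-true As) ⟩
  map (false ∷_) As ++ map (true ∷_) (properSubsets d)             ∎
  where
  open ≡-Reasoning
  As = allSubsets d
  P? = λ J → ¬? (J ≟ˢ full (suc d))
  none-full : ListAll.All (λ J → ¬ J ≡ full (suc d)) (map (false ∷_) As)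
  none-full = ListAll.map⁺ (ListAll.universal (λ _ ()) As)

sum-allSubsets : ∀ d (f : Subset d → ℕ) → sum (map f (allSubsets d)) ≡ f (full d) + sum (map f (properSubsets d))
sum-allSubsets zero    f = refl
sum-allSubsets (suc d) f = begin
  sum (map f (allSubsets (suc d)))                       ≡⟨ sum-++-maps f (false ∷_) (true ∷_) As As ⟩
  Σ₀ + sum (map (f ∘′ (true ∷_)) As)                     ≡⟨ cong (Σ₀ +_) (sum-allSubsets d (f ∘′ (true ∷_))) ⟩
  Σ₀ + (f (full (suc d)) + Σ₁)                           ≡⟨ x∙yz≈y∙xz Σ₀ (f (full (suc d))) Σ₁ ⟩
  f (full (suc d)) + (Σ₀ + Σ₁)
    ≡⟨ cong (f (full (suc d)) +_) (sum-++-maps f (false ∷_) (true ∷_) As (properSubsets d)) ⟨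
  f (full (suc d)) + sum (map f (map (false ∷_) As ++ map (true ∷_) (properSubsets d)))
                                                         ≡⟨ cong (λ Is → f (full (suc d)) + sum (map f Is)) (properSubsets-suc d) ⟨
  f (full (suc d)) + sum (map f (properSubsets (suc d))) ∎
  where
  open ≡-Reasoning
  As = allSubsets d
  Σ₀ = sum (map (f ∘′ (false ∷_)) As)
  Σ₁ = sum (map (f ∘′ (true ∷_)) (properSubsets d))

π-≤ : ∀ {d} (I : Subset d) s → π I s ≤ᵖ s
π-≤ []          []      = []
π-≤ (false ∷ I) (x ∷ s) = z≤n ∷ π-≤ I s
π-≤ (true  ∷ I) (x ∷ s) = ≤-refl ∷ π-≤ I s

π-⊕ : ∀ {d} (I : Subset d) a b → π I (a ⊕ b) ≡ π I a ⊕ π I b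
π-⊕ []          []      []      = refl
π-⊕ (false ∷ I) (x ∷ a) (y ∷ b) = cong (0 ∷_) (π-⊕ I a b)
π-⊕ (true  ∷ I) (x ∷ a) (y ∷ b) = cong (x + y ∷_) (π-⊕ I a b)

π-idem : ∀ {d} (I : Subset d) s → π I (π I s) ≡ π I s
π-idem []          []      = refl
π-idem (false ∷ I) (x ∷ s) = cong (0 ∷_) (π-idem I s)
π-idem (true  ∷ I) (x ∷ s) = cong (x ∷_) (π-idem I s)

π-full : ∀ {d} (s : Point d) → π (full d) s ≡ s
π-full []      = refl
π-full (x ∷ s) = cong (x ∷_) (π-full s)

π-fixes : ∀ {d} → Subset d → Point d → Bool
π-fixes I p = does (π I p ≟ᵖ p)

π-fixes-true : ∀ {d} (I : Subset d) x p → π-fixes (true ∷ I) (x ∷ p) ≡ π-fixes I p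
π-fixes-true I x p = cong (_∧ π-fixes I p) (dec-true (x ≟ x) refl)

sum-π-fixes : ∀ {d} (p : Point d) → sum (map (λ I → 𝟙 (π-fixes I p)) (allSubsets d)) ≡ 2 ^ zeros p
sum-π-fixes []              = refl
sum-π-fixes {suc d} (x ∷ p) = begin
  sum (map (λ I → 𝟙 (π-fixes I (x ∷ p))) (allSubsets (suc d)))        ≡⟨ sum-++-maps _ (false ∷_) (true ∷_) As As ⟩
  firstFree x + sum (map (λ I → 𝟙 (π-fixes (true ∷ I) (x ∷ p))) As)
    ≡⟨ cong (λ Is → firstFree x + sum Is) (map-cong (λ I → cong 𝟙 (π-fixes-true I x p)) As) ⟩
  firstFree x + sum (map (λ I → 𝟙 (π-fixes I p)) As)                  ≡⟨ cong (firstFree x +_) (sum-π-fixes p) ⟩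
  firstFree x + 2 ^ zeros p                                           ≡⟨ firstCoordinate x ⟩
  2 ^ zeros (x ∷ p)                                                   ∎
  where
  open ≡-Reasoning
  As = allSubsets d
  firstFree : ℕ → ℕ
  firstFree x = sum (map (λ I → 𝟙 (does (0 ≟ x) ∧ π-fixes I p)) As)
  firstCoordinate : ∀ x → firstFree x + 2 ^ zeros p ≡ 2 ^ zeros (x ∷ p)
  firstCoordinate zero    = cong₂ _+_ (sum-π-fixes p) (sym (+-identityʳ (2 ^ zeros p)))
  firstCoordinate (suc _) = cong (_+ 2 ^ zeros p) (sum-map-zero As)

∈ᵇ-πˢ : ∀ {d} (S : FinSet d) → (∀ I s → s ∈ S → π I s ∈ S) →
  ∀ I p → 𝟙 (p ∈ᵇ πˢ I S) ≡ 𝟙 (p ∈ᵇ S) * 𝟙 (π-fixes I p)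
∈ᵇ-πˢ S closed I p = trans (𝟙-cong to from) (𝟙-∧ (p ∈ᵇ S) (π-fixes I p))
  where
  to : T (p ∈ᵇ πˢ I S) → T (p ∈ᵇ S ∧ π-fixes I p)
  to p∈πS with ∈-map⁻ (π I) (∈ᵇ⇒∈ (πˢ I S) p∈πS)
  ... | s , s∈S , refl = Equivalence.from T-∧ (∈⇒∈ᵇ S (closed I s s∈S) , ⇒T-does (π I (π I s) ≟ᵖ π I s) (π-idem I s))
  from : T (p ∈ᵇ S ∧ π-fixes I p) → T (p ∈ᵇ πˢ I S)
  from p∈S∧fixed with Equivalence.to T-∧ p∈S∧fixed
  ... | p∈S , fixed = ∈⇒∈ᵇ (πˢ I S) (subst (_∈ πˢ I S) (T-does⇒ (π I p ≟ᵖ p) fixed) (∈-map⁺ (π I) (∈ᵇ⇒∈ S p∈S)))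

∣∣+projSum≡weight : ∀ {d} M (S : FinSet d) → (∀ I s → s ∈ S → π I s ∈ S) → (∀ s → s ∈ S → InBox M s) →
  ∣ S ∣ + projSum S ≡ weight d M (_∈ᵇ S)
∣∣+projSum≡weight {d} M S closed S⊆ = begin
  ∣ S ∣ + projSum S                                         ≡⟨ cong (λ S′ → ∣ S′ ∣ + projSum S) (trans (map-cong π-full S) (map-id S)) ⟨
  ∣ πˢ (full d) S ∣ + projSum S                             ≡⟨ sum-allSubsets d (λ I → ∣ πˢ I S ∣) ⟨
  sum (map (λ I → ∣ πˢ I S ∣) Is)                           ≡⟨ cong sum (map-cong projection-count Is) ⟩
  sum (map (λ I → boxSum d M (λ p → 𝟙 (p ∈ᵇ S) * 𝟙 (π-fixes I p))) Is)
                                                            ≡⟨ boxSum-sum d M Is (λ I p → 𝟙 (p ∈ᵇ S) * 𝟙 (π-fixes I p)) ⟨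
  boxSum d M (λ p → sum (map (λ I → 𝟙 (p ∈ᵇ S) * 𝟙 (π-fixes I p)) Is))
                                                            ≡⟨ boxSum-cong d M (λ p _ → weight-of p) ⟩
  weight d M (_∈ᵇ S)                                        ∎
  where
  open ≡-Reasoning
  Is = allSubsets d
  πˢ⊆ : ∀ I x → x ∈ πˢ I S → InBox M x
  πˢ⊆ I x x∈ with ∈-map⁻ (π I) x∈
  ... | s , s∈S , refl = InBox-antitone (π-≤ I s) (S⊆ s s∈S)
  weight-of : ∀ p → sum (map (λ I → 𝟙 (p ∈ᵇ S) * 𝟙 (π-fixes I p)) Is) ≡ 𝟙 (p ∈ᵇ S) * 2 ^ zeros p
  weight-of p = trans (sum-map-*ˡ _ (𝟙 (p ∈ᵇ S)) Is) (cong (𝟙 (p ∈ᵇ S) *_) (sum-π-fixes p))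
  projection-count : ∀ I → ∣ πˢ I S ∣ ≡ boxSum d M (λ p → 𝟙 (p ∈ᵇ S) * 𝟙 (π-fixes I p))
  projection-count I = trans (∣∣≡count M (πˢ I S) (πˢ⊆ I)) (boxSum-cong d M (λ p _ → ∈ᵇ-πˢ S closed I p))

downward-closed : ∀ {d} {P : Point d → Set} → (∀ i x → P x → ∀ y → y ≤ lookup x i → P (x [ i ]≔ y)) →
  ∀ {p q} → q ≤ᵖ p → P p → P q
downward-closed {zero}  closed []              Pp = Pp
downward-closed {suc d} closed {a ∷ p} {b ∷ q} (b≤a ∷ q≤p) Pp =
  downward-closed (λ i x Px y y≤xᵢ → closed (Fin.suc i) (b ∷ x) Px y y≤xᵢ) q≤p (closed Fin.zero (a ∷ p) Pp b b≤a)

IsDownSet⇒DownClosed : ∀ {d} {X : FinSet d} → IsDownSet X → DownClosed (_∈ᵇ X)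
IsDownSet⇒DownClosed {X = X} X↓ q≤p p∈X = ∈⇒∈ᵇ X (downward-closed X↓ q≤p (∈ᵇ⇒∈ X p∈X))

+ˢ≡cartesianProductWith : ∀ {d} (X Y : FinSet d) → X +ˢ Y ≡ cartesianProductWith _⊕_ X Y
+ˢ≡cartesianProductWith []      Y = refl
+ˢ≡cartesianProductWith (x ∷ X) Y = cong (map (x ⊕_) Y ++_) (+ˢ≡cartesianProductWith X Y)

∈-+ˢ⁺ : ∀ {d} {X Y : FinSet d} {x y} → x ∈ X → y ∈ Y → x ⊕ y ∈ X +ˢ Y
∈-+ˢ⁺ {X = X} {Y} x∈X y∈Y = subst (_ ∈_) (sym (+ˢ≡cartesianProductWith X Y)) (∈-cartesianProductWith⁺ _⊕_ x∈X y∈Y)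

∈-+ˢ⁻ : ∀ {d} (X Y : FinSet d) {s} → s ∈ X +ˢ Y → ∃₂ λ x y → x ∈ X × y ∈ Y × s ≡ x ⊕ y
∈-+ˢ⁻ X Y s∈X+Y = ∈-cartesianProductWith⁻ _⊕_ X Y (subst (_ ∈_) (+ˢ≡cartesianProductWith X Y) s∈X+Y)

+ˢ-π-closed : ∀ {d} {X Y : FinSet d} → IsDownSet X → IsDownSet Y → ∀ I s → s ∈ X +ˢ Y → π I s ∈ X +ˢ Y
+ˢ-π-closed {X = X} {Y} X↓ Y↓ I s s∈X+Y with ∈-+ˢ⁻ X Y s∈X+Y
... | x , y , x∈X , y∈Y , refl = subst (_∈ X +ˢ Y) (sym (π-⊕ I x y))
  (∈-+ˢ⁺ (downward-closed X↓ (π-≤ I x) x∈X) (downward-closed Y↓ (π-≤ I y) y∈Y))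

+ˢ-InBox : ∀ {d N} {X Y : FinSet d} → (∀ x → x ∈ X → InBox N x) → (∀ y → y ∈ Y → InBox N y) →
  ∀ s → s ∈ X +ˢ Y → InBox (N + N) s
+ˢ-InBox {X = X} {Y} X⊆ Y⊆ s s∈X+Y with ∈-+ˢ⁻ X Y s∈X+Y
... | x , y , x∈X , y∈Y , refl = VecAll.zipWith +-mono-< (X⊆ x x∈X) (Y⊆ y y∈Y)

∈ᵇ-+ˢ : ∀ {d} (X Y : FinSet d) a b → T (a ∈ᵇ X) → T (b ∈ᵇ Y) → T ((a ⊕ b) ∈ᵇ (X +ˢ Y))
∈ᵇ-+ˢ X Y a b a∈X b∈Y = ∈⇒∈ᵇ (X +ˢ Y) (∈-+ˢ⁺ (∈ᵇ⇒∈ X a∈X) (∈ᵇ⇒∈ Y b∈Y))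

corollary2p7 : ∀ (d : ℕ) (X Y : FinSet d) → IsDownSet X → IsDownSet Y →
    2 ^ d * (∣ X ∣ ⊓ ∣ Y ∣) ≤ ∣ X +ˢ Y ∣ + projSum (X +ˢ Y)
corollary2p7 d X Y X↓ Y↓ = m*m≤n*n⇒m≤n (begin
  2 ^ d * (∣ X ∣ ⊓ ∣ Y ∣) * (2 ^ d * (∣ X ∣ ⊓ ∣ Y ∣))    ≤⟨ c*[m⊓n]-square≤c*c*[m*n] (2 ^ d) ∣ X ∣ ∣ Y ∣ ⟩
  2 ^ d * 2 ^ d * (∣ X ∣ * ∣ Y ∣)                        ≡⟨ *-assoc (2 ^ d * 2 ^ d) ∣ X ∣ ∣ Y ∣ ⟨
  2 ^ d * 2 ^ d * ∣ X ∣ * ∣ Y ∣                          ≡⟨ cong₂ (λ a b → 2 ^ d * 2 ^ d * a * b)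
                                                              (∣∣≡count N X X⊆) (∣∣≡count N Y Y⊆) ⟩
  2 ^ d * 2 ^ d * count d N (_∈ᵇ X) * count d N (_∈ᵇ Y)  ≤⟨ counts≤weight d N (N + N) ≤-refl (_∈ᵇ X) (_∈ᵇ Y) (_∈ᵇ S)
                                                              (IsDownSet⇒DownClosed X↓) (IsDownSet⇒DownClosed Y↓) (∈ᵇ-+ˢ X Y) ⟩
  weight d (N + N) (_∈ᵇ S) * weight d (N + N) (_∈ᵇ S)    ≡⟨ cong (λ w → w * w)
                                                              (∣∣+projSum≡weight (N + N) S (+ˢ-π-closed X↓ Y↓) (+ˢ-InBox X⊆ Y⊆)) ⟨
  (∣ S ∣ + projSum S) * (∣ S ∣ + projSum S)               ∎)
  where
  open ≤-Reasoning
  S = X +ˢ Y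
  N = proj₁ (bounded (X ++ Y))
  X⊆ : ∀ x → x ∈ X → InBox N x
  X⊆ x x∈X = proj₂ (bounded (X ++ Y)) x (∈-++⁺ˡ x∈X)
  Y⊆ : ∀ y → y ∈ Y → InBox N y
  Y⊆ y y∈Y = proj₂ (bounded (X ++ Y)) y (∈-++⁺ʳ X y∈Y)
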